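{- Let $G$ be an undirected graph with finite vertex set $V(G)$ and finite edge set $E(G)$. For $v\in V(G)$, let $E(v)$ be the set of edges incident at $v$ and $L(v)$ the set of loops at $v$. Let $\mathbb{Z}_2\cdot E(G)=\bigoplus_{x\in E(G)}\mathbb{Z}_2\cdot x$ (a vector space over $\mathbb{Z}_2$) and let $S$ be the subspace spanned by $\{\sum_{x\in E(v)\setminus L(v)}x: v\in V(G)\}$. 1. $\alpha_{undirected}(G)\le|E(G)|-\dim_{\mathbb{Z}_2}S\le\beta_{undirected}(G)$. In particular, $|E(G)|>\dim_{\mathbb{Z}_2}S$ if and only if there is an undirected cycle in $G$. 2. Let $\mathbb{Z}_2\cdot E(v)=\bigoplus_{x\in E(v)}\mathbb{Z}_2\cdot x\subset\mathbb{Z}_2\cdot E(G)$. Then $$\alpha_{undirected}(G,v)\le|E(v)|-\dim_{\mathbb{Z}_2}(\mathbb{Z}_2\cdot E(v))\cap S=\dim_{\mathbb{Z}_2}(\mathbb{Z}_2\cdot E(v)+S)-\dim_{\mathbb{Z}_2}S\le\beta_{undirected}(G,v).$$ In particular, $|E(v)|>\dim_{\mathbb{Z}_2}(\mathbb{Z}_2\cdot E(v))\cap S$ if and only if there is an undirected cycle in $G$ containing $v$. 3. For an edge $x$ of $G$, there exists an undirected cycle in $G$ containing $x$ if and only if $x\notin S$.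
   Context: Undirected graphs may have loops and multiple edges. An undirected cycle is a sequence $v_0,x_0,v_1,\dots,v_n,x_n,v_0$ with $v_0,\dots,v_n$ pairwise distinct vertices and $x_i$ an edge joining $v_i$ and $v_{i+1}$ (indices mod $n+1$), up to circular permutation. $\alpha_{undirected}(G)$ is the maximal number of pairwise edge-disjoint undirected cycles; $\beta_{undirected}(G)$ is the minimal number of edges whose removal destroys all undirected cycles; $\alpha_{undirected}(G,v)$ is the maximal number of pairwise edge-disjoint undirected cycles each containing $v$; $\beta_{undirected}(G,v)$ is the minimal number of edges incident at $v$ whose removal destroys all undirected cycles containing $v$. -}

module Defs where

open import Data.Nat using (ℕ; zero; suc)
open import Data.Fin using (Fin; zero; suc; inject₁; fromℕ; _≟_)
open import Data.Fin.Subset using (Subset; _∈_; _⊆_; ⊥; ⁅_⁆)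
open import Data.Bool using (Bool; true; false; _xor_; _∧_; _∨_; not; if_then_else_)
open import Data.Vec using (Vec; tabulate; zipWith)
open import Data.Product using (Σ; ∃; _×_; _,_; proj₁; proj₂)
open import Data.Sum using (_⊎_)
open import Data.List using (List)
open import Function using (_∘_)
open import Relation.Nullary using (¬_)
open import Relation.Nullary.Decidable using (⌊_⌋)
open import Relation.Binary.PropositionalEquality using (_≡_; _≢_)

-- Finite undirected graphs with loops and multiple edges.
-- Vertices are Fin n, edges are Fin m; each edge has an (unordered)
-- pair of end vertices, given as an ordered pair for convenience.

record Graph (n m : ℕ) : Set where
  field
    ends : Fin m → Fin n × Fin n

open Graph public

module _ {n m : ℕ} (G : Graph n m) where

  Joins : Fin m → Fin n → Fin n → Set
  Joins e a b = ends G e ≡ (a , b) ⊎ ends G e ≡ (b , a)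

  incident : Fin m → Fin n → Bool
  incident e v = ⌊ proj₁ (ends G e) ≟ v ⌋ ∨ ⌊ proj₂ (ends G e) ≟ v ⌋

  isLoop : Fin m → Bool
  isLoop e = ⌊ proj₁ (ends G e) ≟ proj₂ (ends G e) ⌋

  E[_] : Fin n → Subset m
  E[ v ] = tabulate (λ e → incident e v)

  vertexVec : Fin n → Subset m
  vertexVec v = tabulate (λ e → incident e v ∧ not (isLoop e))

  -- An undirected cycle v₀,x₀,v₁,…,v_k,x_k,v₀  (k+1 vertices, k+1 edges),
  -- vertices pairwise distinct, edges pairwise distinct.
  record Cycle : Set where
    field
      k     : ℕ
      verts : Fin (suc k) → Fin n
      edges : Fin (suc k) → Fin m
      verts-distinct : ∀ i j → verts i ≡ verts j → i ≡ j
      edges-distinct : ∀ i j → edges i ≡ edges j → i ≡ j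
      joins-step  : ∀ (i : Fin k) → Joins (edges (inject₁ i)) (verts (inject₁ i)) (verts (suc i))
      joins-close : Joins (edges (fromℕ k)) (verts (fromℕ k)) (verts zero)

  open Cycle public

  ContainsVertex : Cycle → Fin n → Set
  ContainsVertex c v = ∃ λ i → verts c i ≡ v

  ContainsEdge : Cycle → Fin m → Set
  ContainsEdge c x = ∃ λ i → edges c i ≡ x

  EdgeDisjoint : Cycle → Cycle → Set
  EdgeDisjoint c d = ∀ i j → edges c i ≢ edges d j

  Hits : Subset m → Cycle → Set
  Hits F c = ∃ λ i → edges c i ∈ F

-- Linear algebra over Z₂ on Z₂·E(G) = Subset m (= Vec Bool m).

module _ {m : ℕ} where

  _⊕_ : Subset m → Subset m → Subset m
  _⊕_ = zipWith _xor_

  combo : ∀ {k} → (Fin k → Bool) → (Fin k → Subset m) → Subset m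
  combo {zero}  c f = ⊥
  combo {suc k} c f = (if c zero then f zero else ⊥) ⊕ combo (c ∘ suc) (f ∘ suc)

  Span : ∀ {k} → (Fin k → Subset m) → Subset m → Set
  Span f x = ∃ λ c → combo c f ≡ x

  LinIndep : ∀ {k} → (Fin k → Subset m) → Set
  LinIndep {k} f = ∀ (c : Fin k → Bool) → combo c f ≡ ⊥ → ∀ i → c i ≡ false

  IsBasis : ∀ {k} → (Subset m → Set) → (Fin k → Subset m) → Set
  IsBasis P f = LinIndep f × (∀ i → P (f i)) × (∀ x → P x → Span f x)

  HasDim : (Subset m → Set) → ℕ → Set
  HasDim P d = Σ (Fin d → Subset m) (IsBasis P)

  _∩ˢ_ : (Subset m → Set) → (Subset m → Set) → Subset m → Set
  (P ∩ˢ Q) x = P x × Q x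

  _+ˢ_ : (Subset m → Set) → (Subset m → Set) → Subset m → Set
  (P +ˢ Q) x = ∃ λ y → ∃ λ z → P y × Q z × x ≡ y ⊕ z

module _ {n m : ℕ} (G : Graph n m) where

  S : Subset m → Set
  S = Span (vertexVec G)

  Z₂E[_] : Fin n → Subset m → Set
  Z₂E[ v ] x = x ⊆ E[_] G v

-- Over Z₂ the space S spanned by the vertex vectors is the cut space of G, and the parity of a vector
-- along a cycle is a linear functional vanishing on S. So the unit vectors of one edge from each of α
-- edge-disjoint cycles are independent modulo S (each cycle's parity detects its own edge only), which
-- bounds α by |E| − dim S, and by |E(v)| − dim(Z₂·E(v) ∩ S) inside Z₂·E(v). Conversely, growing the set
-- of vertices reachable from one end of an edge x along edges outside F ∪ {x} either closes a cycle
-- through x avoiding F or produces a cut agreeing with x off F. Hence if F meets every cycle, every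
-- vector is a cut plus a vector supported on F, and counting gives |E| ≤ dim S + |F|; F = ∅ is Part 3.
-- The identity in Part 2 is rank–nullity for deleting the coordinates in E(v). All dimension bounds
-- come from counting: k independent vectors have 2^k distinct linear combinations.
module Submission where

open import Defs
open import Algebra.Bundles using (CommutativeRing)
open import Data.Bool using (Bool; true; false; _xor_; _∧_; _∨_; not; if_then_else_)
  renaming (_≟_ to _≟ᴮ_)
open import Data.Bool.Properties
  using (xor-assoc; xor-comm; xor-same; xor-identityˡ; xor-identityʳ; ∧-zeroʳ; ∧-identityʳ;
         ∧-distribˡ-xor; ∨-zeroʳ; ¬-not; xor-∧-commutativeRing)
open import Data.Empty using (⊥-elim) renaming (⊥ to Empty)
open import Data.Fin using (Fin; zero; suc; inject₁; fromℕ; _≟_; _↑ˡ_; _↑ʳ_; splitAt)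
open import Data.Fin.Properties using (splitAt⁻¹-↑ˡ; splitAt⁻¹-↑ʳ; any?)
open import Data.Fin.Relation.Unary.Top using (view; ‵fromℕ; ‵inject₁)
open import Data.Fin.Subset
  using (Subset; ∣_∣; _⊆_; ⁅_⁆; ⊥; ⊤; _∈_; _∉_; _─_; _∪_; _⊃_; inside; outside)
open import Data.Fin.Subset.Induction using (Acc; acc; ⊃-wellFounded)
open import Data.Fin.Subset.Properties
  using (⊥⊆; ⊆⊤; ∉⊥; ∈⊤; drop-∷-⊆; out⊆; in⊆in; ⊆-antisym; _⊆?_; _∈?_; anySubset?; ∣⊤∣≡n; ∣⊥∣≡0;
         x∈⁅x⁆; x∈⁅y⁆⇒x≡y; x∈p∪q⁺; x∈p∪q⁻; p⊆p∪q)
open import Data.List using (List; []; _∷_; [_]; map; length; cartesianProductWith)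
  renaming (_++_ to _++ₗ_)
open import Data.List.Properties using (length-map; length-++)
open import Data.List.Membership.Propositional using () renaming (_∈_ to _∈ₗ_)
open import Data.List.Membership.Propositional.Properties
  using (∈-map⁺; ∈-map⁻; ∈-++⁺ˡ; ∈-++⁺ʳ; ∈-++⁻; ∈-cartesianProductWith⁺)
open import Data.List.Relation.Unary.All using (All; []; _∷_; universal)
  renaming (lookup to lookupᴬ; map to mapᴬ; zipWith to zipWithᴬ)
open import Data.List.Relation.Unary.AllPairs using (AllPairs; []; _∷_)
open import Data.List.Relation.Unary.Any using (here; there)
open import Data.List.Relation.Unary.Unique.Propositional using (Unique)
import Data.List.Relation.Unary.Unique.Propositional.Properties as Unique
open import Data.Nat using (ℕ; zero; suc; _+_; _*_; _^_; _≤_; _<_; _∸_; z≤n; s≤s)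
open import Data.Nat.Properties
  using (+-identityʳ; +-suc; +-comm; ≤-antisym; ≮⇒≥; <⇒≱; ^-monoʳ-<; ^-distribˡ-+-*;
         m+n≤o⇒m≤o∸n; m≤n+o⇒m∸n≤o; [m+n]∸[m+o]≡n∸o)
open import Data.Product using (Σ; ∃; _×_; _,_; proj₁; proj₂)
open import Data.Sum using (_⊎_; inj₁; inj₂)
open import Data.Vec using ([]; _∷_; here; lookup; tabulate)
open import Data.Vec.Properties
  using (≡-dec; ∷-injectiveʳ; lookup∘tabulate; lookup-zipWith; lookup-replicate; tabulate∘lookup;
         tabulate-cong; []=⇒lookup; lookup⇒[]=)
open import Data.Vec.Relation.Binary.Pointwise.Inductive
  using (Pointwise-≡⇒≡; zipWith-assoc; zipWith-comm; zipWith-identityˡ; zipWith-identityʳ)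
import Data.Vec.Functional as Vector
open import Data.Vec.Functional using (_++_)
open import Data.Vec.Functional.Properties using (lookup-++ˡ; lookup-++ʳ)
open import Function using (_∘_)
open import Function.Bundles using (_⇔_; mk⇔)
open import Relation.Nullary using (¬_; Dec; yes; no)
open import Relation.Nullary.Decidable using (⌊_⌋; map′; _×-dec_; ¬?; decidable-stable)
open import Relation.Binary.PropositionalEquality hiding ([_])

open import Algebra.Properties.Semiring.Sum (CommutativeRing.semiring xor-∧-commutativeRing)
  using (sum; sum-cong-≗; ∑-distrib-+; sum-replicate-zero; sum-init-last)

-- Linear algebra over Z₂

true≢false : true ≢ false
true≢false ()

xor≡false⇒≡ : ∀ {a b} → a xor b ≡ false → a ≡ b
xor≡false⇒≡ {false} {false} _ = refl
xor≡false⇒≡ {true}  {true}  _ = refl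

δ : ∀ {k} → Fin k → Fin k → Bool
δ zero    zero    = true
δ zero    (suc j) = false
δ (suc i) zero    = false
δ (suc i) (suc j) = δ i j

δ-refl : ∀ {k} (i : Fin k) → δ i i ≡ true
δ-refl zero    = refl
δ-refl (suc i) = δ-refl i

δ-sym : ∀ {k} (i j : Fin k) → δ i j ≡ δ j i
δ-sym zero    zero    = refl
δ-sym zero    (suc j) = refl
δ-sym (suc i) zero    = refl
δ-sym (suc i) (suc j) = δ-sym i j

δ≡true⇒≡ : ∀ {k} {i j : Fin k} → δ i j ≡ true → i ≡ j
δ≡true⇒≡ {i = zero}  {zero}  _ = refl
δ≡true⇒≡ {i = suc i} {suc j} e = cong suc (δ≡true⇒≡ e)

δ-≢ : ∀ {k} {i j : Fin k} → i ≢ j → δ i j ≡ false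
δ-≢ {i = zero}  {zero}  i≢j = ⊥-elim (i≢j refl)
δ-≢ {i = zero}  {suc j} _   = refl
δ-≢ {i = suc i} {zero}  _   = refl
δ-≢ {i = suc i} {suc j} i≢j = δ-≢ (i≢j ∘ cong suc)

⌊≟⌋≡δ : ∀ {k} (i j : Fin k) → ⌊ i ≟ j ⌋ ≡ δ i j
⌊≟⌋≡δ i j with i ≟ j
... | yes refl = sym (δ-refl i)
... | no i≢j   = sym (δ-≢ i≢j)

sum-false : ∀ {k} (g : Fin k → Bool) → (∀ i → g i ≡ false) → sum g ≡ false
sum-false {k} g g≡false = trans (sum-cong-≗ g≡false) (sum-replicate-zero k)

sum-δ : ∀ {k} (g : Fin k → Bool) (j : Fin k) → sum (λ i → g i ∧ δ i j) ≡ g j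
sum-δ g zero    = trans (cong₂ _xor_ (∧-identityʳ (g zero)) (sum-false _ (λ i → ∧-zeroʳ (g (suc i)))))
                        (xor-identityʳ (g zero))
sum-δ g (suc j) = trans (cong (_xor sum (λ i → g (suc i) ∧ δ i j)) (∧-zeroʳ (g zero))) (sum-δ (g ∘ suc) j)

⊕-self : ∀ {m} (x : Subset m) → x ⊕ x ≡ ⊥
⊕-self []      = refl
⊕-self (b ∷ x) = cong₂ _∷_ (xor-same b) (⊕-self x)

module _ {m : ℕ} where

  ⊕-assoc : (x y z : Subset m) → (x ⊕ y) ⊕ z ≡ x ⊕ (y ⊕ z)
  ⊕-assoc x y z = Pointwise-≡⇒≡ (zipWith-assoc xor-assoc x y z)

  ⊕-comm : (x y : Subset m) → x ⊕ y ≡ y ⊕ x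
  ⊕-comm x y = Pointwise-≡⇒≡ (zipWith-comm xor-comm x y)

  ⊕-identityˡ : (x : Subset m) → ⊥ ⊕ x ≡ x
  ⊕-identityˡ x = Pointwise-≡⇒≡ (zipWith-identityˡ xor-identityˡ x)

  ⊕-identityʳ : (x : Subset m) → x ⊕ ⊥ ≡ x
  ⊕-identityʳ x = Pointwise-≡⇒≡ (zipWith-identityʳ xor-identityʳ x)

  ⊕-cancelˡ : (x y : Subset m) → x ⊕ (x ⊕ y) ≡ y
  ⊕-cancelˡ x y = begin
    x ⊕ (x ⊕ y) ≡⟨ ⊕-assoc x x y ⟨
    (x ⊕ x) ⊕ y ≡⟨ cong (_⊕ y) (⊕-self x) ⟩
    ⊥ ⊕ y       ≡⟨ ⊕-identityˡ y ⟩
    y           ∎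
    where open ≡-Reasoning

  ⊕-cancelʳ : (x y : Subset m) → (x ⊕ y) ⊕ y ≡ x
  ⊕-cancelʳ x y = trans (⊕-assoc x y y) (trans (cong (x ⊕_) (⊕-self y)) (⊕-identityʳ x))

  ⊕≡⊥⇒≡ : {x y : Subset m} → x ⊕ y ≡ ⊥ → x ≡ y
  ⊕≡⊥⇒≡ {x} {y} x⊕y≡⊥ = trans (sym (⊕-cancelʳ x y)) (trans (cong (_⊕ y) x⊕y≡⊥) (⊕-identityˡ y))

  ⊕-interchange : (a b c d : Subset m) → (a ⊕ b) ⊕ (c ⊕ d) ≡ (a ⊕ c) ⊕ (b ⊕ d)
  ⊕-interchange a b c d = begin
    (a ⊕ b) ⊕ (c ⊕ d) ≡⟨ ⊕-assoc a b (c ⊕ d) ⟩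
    a ⊕ (b ⊕ (c ⊕ d)) ≡⟨ cong (a ⊕_) (⊕-assoc b c d) ⟨
    a ⊕ ((b ⊕ c) ⊕ d) ≡⟨ cong (λ z → a ⊕ (z ⊕ d)) (⊕-comm b c) ⟩
    a ⊕ ((c ⊕ b) ⊕ d) ≡⟨ cong (a ⊕_) (⊕-assoc c b d) ⟩
    a ⊕ (c ⊕ (b ⊕ d)) ≡⟨ ⊕-assoc a c (b ⊕ d) ⟨
    (a ⊕ c) ⊕ (b ⊕ d) ∎
    where open ≡-Reasoning

  lookup-⊕ : (x y : Subset m) (e : Fin m) → lookup (x ⊕ y) e ≡ lookup x e xor lookup y e
  lookup-⊕ x y e = lookup-zipWith _xor_ e x y

  lookup-⊥ : (e : Fin m) → lookup (⊥ {m}) e ≡ false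
  lookup-⊥ e = lookup-replicate e false

  lookup-ext : {x y : Subset m} → (∀ e → lookup x e ≡ lookup y e) → x ≡ y
  lookup-ext {x} {y} h = trans (sym (tabulate∘lookup x)) (trans (tabulate-cong h) (tabulate∘lookup y))

  ∈⇒lookup : ∀ {e} {x : Subset m} → e ∈ x → lookup x e ≡ true
  ∈⇒lookup = []=⇒lookup

  lookup⇒∈ : ∀ {e} {x : Subset m} → lookup x e ≡ true → e ∈ x
  lookup⇒∈ = lookup⇒[]= _ _

  ∈-⊕⁻ : ∀ {e} (x y : Subset m) → e ∈ x ⊕ y → e ∈ x ⊎ e ∈ y
  ∈-⊕⁻ {e} x y e∈x⊕y with lookup x e in eq
  ... | true  = inj₁ (lookup⇒∈ eq)
  ... | false = inj₂ (lookup⇒∈ (trans (sym (cong (_xor lookup y e) eq))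
                                 (trans (sym (lookup-⊕ x y e)) (∈⇒lookup e∈x⊕y))))

  ⊕-⊆ : {x y T : Subset m} → x ⊆ T → y ⊆ T → x ⊕ y ⊆ T
  ⊕-⊆ {x} {y} x⊆T y⊆T e∈x⊕y with ∈-⊕⁻ x y e∈x⊕y
  ... | inj₁ e∈x = x⊆T e∈x
  ... | inj₂ e∈y = y⊆T e∈y

  ⁅⁆⊆ : ∀ {e} {T : Subset m} → e ∈ T → ⁅ e ⁆ ⊆ T
  ⁅⁆⊆ {e} e∈T x∈⁅e⁆ = subst (_∈ _) (sym (x∈⁅y⁆⇒x≡y e x∈⁅e⁆)) e∈T

lookup-⁅⁆ : ∀ {m} (x e : Fin m) → lookup ⁅ x ⁆ e ≡ δ x e
lookup-⁅⁆ zero    zero    = refl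
lookup-⁅⁆ zero    (suc e) = lookup-⊥ e
lookup-⁅⁆ (suc x) zero    = refl
lookup-⁅⁆ (suc x) (suc e) = lookup-⁅⁆ x e

∉⇒lookup≡false : ∀ {k} {R : Subset k} {v} → v ∉ R → lookup R v ≡ false
∉⇒lookup≡false v∉R = ¬-not (v∉R ∘ lookup⇒∈)

lookup≡false⇒∉ : ∀ {k} {R : Subset k} {v} → lookup R v ≡ false → v ∉ R
lookup≡false⇒∉ R[v]≡false v∈R = true≢false (trans (sym (∈⇒lookup v∈R)) R[v]≡false)

─-⊕ : ∀ {m} (x y E : Subset m) → (x ⊕ y) ─ E ≡ (x ─ E) ⊕ (y ─ E)
─-⊕ []      []      []            = refl
─-⊕ (a ∷ x) (b ∷ y) (outside ∷ E) = cong ((a xor b) ∷_) (─-⊕ x y E)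
─-⊕ (a ∷ x) (b ∷ y) (inside ∷ E)  = cong (outside ∷_) (─-⊕ x y E)

─≡⊥⇒⊆ : ∀ {m} {x E : Subset m} → x ─ E ≡ ⊥ → x ⊆ E
─≡⊥⇒⊆ {x = []}          {[]}          _  = λ ()
─≡⊥⇒⊆ {x = outside ∷ x} {outside ∷ E} eq = out⊆ (─≡⊥⇒⊆ (∷-injectiveʳ eq))
─≡⊥⇒⊆ {x = outside ∷ x} {inside ∷ E}  eq = out⊆ (─≡⊥⇒⊆ (∷-injectiveʳ eq))
─≡⊥⇒⊆ {x = inside ∷ x}  {inside ∷ E}  eq = in⊆in (─≡⊥⇒⊆ (∷-injectiveʳ eq))

⊆⇒─≡⊥ : ∀ {m} {x E : Subset m} → x ⊆ E → x ─ E ≡ ⊥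
⊆⇒─≡⊥ {x = []}          {[]}          _   = refl
⊆⇒─≡⊥ {x = outside ∷ x} {outside ∷ E} x⊆E = cong (outside ∷_) (⊆⇒─≡⊥ (drop-∷-⊆ x⊆E))
⊆⇒─≡⊥ {x = _ ∷ x}       {inside ∷ E}  x⊆E = cong (outside ∷_) (⊆⇒─≡⊥ (drop-∷-⊆ x⊆E))
⊆⇒─≡⊥ {x = inside ∷ x}  {outside ∷ E} x⊆E with () ← x⊆E here

scale : ∀ {m} → Bool → Subset m → Subset m
scale b x = if b then x else ⊥

lookup-scale : ∀ {m} (b : Bool) (x : Subset m) (e : Fin m) → lookup (scale b x) e ≡ b ∧ lookup x e
lookup-scale false x e = lookup-⊥ e
lookup-scale true  x e = refl

scale-xor : ∀ {m} (a b : Bool) (x : Subset m) → scale (a xor b) x ≡ scale a x ⊕ scale b x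
scale-xor false false x = sym (⊕-identityˡ ⊥)
scale-xor false true  x = sym (⊕-identityˡ x)
scale-xor true  false x = sym (⊕-identityʳ x)
scale-xor true  true  x = sym (⊕-self x)

module _ {m : ℕ} where

  lookup-combo : ∀ {k} (c : Fin k → Bool) (f : Fin k → Subset m) (e : Fin m) →
                 lookup (combo c f) e ≡ sum (λ i → c i ∧ lookup (f i) e)
  lookup-combo {zero}  c f e = lookup-⊥ e
  lookup-combo {suc k} c f e = trans (lookup-⊕ (scale (c zero) (f zero)) _ e)
    (cong₂ _xor_ (lookup-scale (c zero) (f zero) e) (lookup-combo (c ∘ suc) (f ∘ suc) e))

  combo-cong : ∀ {k} {c c′ : Fin k → Bool} (f : Fin k → Subset m) →
               (∀ i → c i ≡ c′ i) → combo c f ≡ combo c′ f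
  combo-cong {zero}  f c≗c′ = refl
  combo-cong {suc k} f c≗c′ =
    cong₂ (λ b z → scale b (f zero) ⊕ z) (c≗c′ zero) (combo-cong (f ∘ suc) (c≗c′ ∘ suc))

  combo-congʳ : ∀ {k} (c : Fin k → Bool) {f g : Fin k → Subset m} →
                (∀ i → f i ≡ g i) → combo c f ≡ combo c g
  combo-congʳ {zero}  c f≗g = refl
  combo-congʳ {suc k} c f≗g =
    cong₂ (λ x z → scale (c zero) x ⊕ z) (f≗g zero) (combo-congʳ (c ∘ suc) (f≗g ∘ suc))

  combo-false : ∀ {k} (f : Fin k → Subset m) → combo (λ _ → false) f ≡ ⊥
  combo-false {zero}  f = refl
  combo-false {suc k} f = trans (⊕-identityˡ _) (combo-false (f ∘ suc))

  combo-xor : ∀ {k} (c c′ : Fin k → Bool) (f : Fin k → Subset m) →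
              combo (λ i → c i xor c′ i) f ≡ combo c f ⊕ combo c′ f
  combo-xor {zero}  c c′ f = sym (⊕-identityˡ ⊥)
  combo-xor {suc k} c c′ f = trans
    (cong₂ _⊕_ (scale-xor (c zero) (c′ zero) (f zero)) (combo-xor (c ∘ suc) (c′ ∘ suc) (f ∘ suc)))
    (⊕-interchange _ _ _ _)

  combo-δ : ∀ {k} (f : Fin k → Subset m) (j : Fin k) → combo (δ j) f ≡ f j
  combo-δ f zero    = trans (cong (f zero ⊕_) (combo-false (f ∘ suc))) (⊕-identityʳ (f zero))
  combo-δ f (suc j) = trans (⊕-identityˡ _) (combo-δ (f ∘ suc) j)

  combo-⁅⁆ : (x : Subset m) → combo (lookup x) ⁅_⁆ ≡ x
  combo-⁅⁆ x = lookup-ext λ e → trans (lookup-combo (lookup x) ⁅_⁆ e)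
    (trans (sum-cong-≗ (λ i → cong (lookup x i ∧_) (lookup-⁅⁆ i e))) (sum-δ (lookup x) e))

  additive-⊥ : ∀ {m′} (L : Subset m → Subset m′) →
               (∀ x y → L (x ⊕ y) ≡ L x ⊕ L y) → L ⊥ ≡ ⊥
  additive-⊥ L L-⊕ = trans (cong L (sym (⊕-self ⊥))) (trans (L-⊕ ⊥ ⊥) (⊕-self (L ⊥)))

  additive-combo : ∀ {m′} (L : Subset m → Subset m′) → (∀ x y → L (x ⊕ y) ≡ L x ⊕ L y) →
                   ∀ {k} (c : Fin k → Bool) (f : Fin k → Subset m) → L (combo c f) ≡ combo c (L ∘ f)
  additive-combo L L-⊕ {zero}  c f = additive-⊥ L L-⊕
  additive-combo L L-⊕ {suc k} c f =
    trans (L-⊕ _ _) (cong₂ _⊕_ (L-scale (c zero)) (additive-combo L L-⊕ (c ∘ suc) (f ∘ suc)))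
    where
      L-scale : ∀ b → L (scale b (f zero)) ≡ scale b (L (f zero))
      L-scale false = additive-⊥ L L-⊕
      L-scale true  = refl

record IsSubspace {m : ℕ} (P : Subset m → Set) : Set where
  field
    ⊥-closed : P ⊥
    ⊕-closed : ∀ {x y} → P x → P y → P (x ⊕ y)

open IsSubspace

module _ {m : ℕ} where

  combo-closed : {P : Subset m → Set} → IsSubspace P → ∀ {k} (c : Fin k → Bool) (f : Fin k → Subset m) →
                 (∀ i → c i ≡ true → P (f i)) → P (combo c f)
  combo-closed P-sub {zero}  c f f∈P = ⊥-closed P-sub
  combo-closed {P} P-sub {suc k} c f f∈P =
    ⊕-closed P-sub (head∈P (c zero) refl) (combo-closed P-sub (c ∘ suc) (f ∘ suc) (f∈P ∘ suc))
    where
      head∈P : ∀ b → c zero ≡ b → P (scale b (f zero))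
      head∈P false _   = ⊥-closed P-sub
      head∈P true  c≡b = f∈P zero c≡b

  units-closed : {P : Subset m → Set} → IsSubspace P → (x : Subset m) →
                 (∀ {e} → e ∈ x → P ⁅ e ⁆) → P x
  units-closed {P} P-sub x units∈P =
    subst P (combo-⁅⁆ x) (combo-closed P-sub (lookup x) ⁅_⁆ (λ e x[e] → units∈P (lookup⇒∈ x[e])))

  Span-isSubspace : ∀ {k} (f : Fin k → Subset m) → IsSubspace (Span f)
  Span-isSubspace f = record
    { ⊥-closed = (λ _ → false) , combo-false f
    ; ⊕-closed = λ { (c , refl) (c′ , refl) → (λ i → c i xor c′ i) , combo-xor c c′ f }
    }

  Span-gen : ∀ {k} (f : Fin k → Subset m) (j : Fin k) → Span f (f j)
  Span-gen f j = δ j , combo-δ f j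

  Span-combo : ∀ {k p} {f : Fin k → Subset m} (g : Fin p → Subset m) →
               (∀ i → Span g (f i)) → ∀ c → Span g (combo c f)
  Span-combo g f∈g c = combo-closed (Span-isSubspace g) c _ (λ i _ → f∈g i)

  ⊆-isSubspace : (T : Subset m) → IsSubspace (_⊆ T)
  ⊆-isSubspace T = record { ⊥-closed = ⊥⊆ ; ⊕-closed = ⊕-⊆ }

  ∩-isSubspace : {P Q : Subset m → Set} → IsSubspace P → IsSubspace Q → IsSubspace (P ∩ˢ Q)
  ∩-isSubspace P-sub Q-sub = record
    { ⊥-closed = ⊥-closed P-sub , ⊥-closed Q-sub
    ; ⊕-closed = λ (px , qx) (py , qy) → ⊕-closed P-sub px py , ⊕-closed Q-sub qx qy
    }

  +-isSubspace : {P Q : Subset m → Set} → IsSubspace P → IsSubspace Q → IsSubspace (P +ˢ Q)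
  +-isSubspace P-sub Q-sub = record
    { ⊥-closed = ⊥ , ⊥ , ⊥-closed P-sub , ⊥-closed Q-sub , sym (⊕-self ⊥)
    ; ⊕-closed = λ { (y , z , py , qz , refl) (y′ , z′ , py′ , qz′ , refl) →
        y ⊕ y′ , z ⊕ z′ , ⊕-closed P-sub py py′ , ⊕-closed Q-sub qz qz′ , ⊕-interchange y z y′ z′ }
    }

  functional-kernel : (ψ : Subset m → Bool) → (∀ x y → ψ (x ⊕ y) ≡ ψ x xor ψ y) →
                      IsSubspace (λ y → ψ y ≡ false)
  functional-kernel ψ ψ-⊕ = record
    { ⊥-closed = trans (cong ψ (sym (⊕-self ⊥))) (trans (ψ-⊕ ⊥ ⊥) (xor-same (ψ ⊥)))
    ; ⊕-closed = λ {x} {y} ψx≡false ψy≡false → trans (ψ-⊕ x y) (cong₂ _xor_ ψx≡false ψy≡false)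
    }

-- Counting and dimension

subsets : ∀ {m} → Subset m → List (Subset m)
subsets []            = [ [] ]
subsets (outside ∷ T) = map (outside ∷_) (subsets T)
subsets (inside ∷ T)  = map (outside ∷_) (subsets T) ++ₗ map (inside ∷_) (subsets T)

length-subsets : ∀ {m} (T : Subset m) → length (subsets T) ≡ 2 ^ ∣ T ∣
length-subsets []            = refl
length-subsets (outside ∷ T) = trans (length-map (outside ∷_) (subsets T)) (length-subsets T)
length-subsets (inside ∷ T)  = begin
  length (map (outside ∷_) (subsets T) ++ₗ map (inside ∷_) (subsets T))
    ≡⟨ length-++ (map (outside ∷_) (subsets T)) ⟩
  length (map (outside ∷_) (subsets T)) + length (map (inside ∷_) (subsets T))
    ≡⟨ cong₂ _+_ (length-map (outside ∷_) (subsets T)) (length-map (inside ∷_) (subsets T)) ⟩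
  length (subsets T) + length (subsets T)
    ≡⟨ cong₂ _+_ (length-subsets T) (trans (length-subsets T) (sym (+-identityʳ _))) ⟩
  2 ^ suc ∣ T ∣ ∎
  where open ≡-Reasoning

subsets-unique : ∀ {m} (T : Subset m) → Unique (subsets T)
subsets-unique []            = [] ∷ []
subsets-unique (outside ∷ T) = Unique.map⁺ ∷-injectiveʳ (subsets-unique T)
subsets-unique (inside ∷ T)  =
  Unique.++⁺ (Unique.map⁺ ∷-injectiveʳ (subsets-unique T)) (Unique.map⁺ ∷-injectiveʳ (subsets-unique T))
             disjoint
  where
    disjoint : ∀ {x} → ¬ (x ∈ₗ map (outside ∷_) (subsets T) × x ∈ₗ map (inside ∷_) (subsets T))
    disjoint (p , q) with ∈-map⁻ (outside ∷_) p | ∈-map⁻ (inside ∷_) q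
    ... | _ , _ , refl | _ , _ , ()

∈-subsets⁺ : ∀ {m} {T x : Subset m} → x ⊆ T → x ∈ₗ subsets T
∈-subsets⁺ {T = []}          {[]}          _   = here refl
∈-subsets⁺ {T = outside ∷ T} {outside ∷ x} x⊆T = ∈-map⁺ (outside ∷_) (∈-subsets⁺ (drop-∷-⊆ x⊆T))
∈-subsets⁺ {T = outside ∷ T} {inside ∷ x}  x⊆T with () ← x⊆T here
∈-subsets⁺ {T = inside ∷ T}  {outside ∷ x} x⊆T =
  ∈-++⁺ˡ (∈-map⁺ (outside ∷_) (∈-subsets⁺ (drop-∷-⊆ x⊆T)))
∈-subsets⁺ {T = inside ∷ T}  {inside ∷ x}  x⊆T =
  ∈-++⁺ʳ (map (outside ∷_) (subsets T)) (∈-map⁺ (inside ∷_) (∈-subsets⁺ (drop-∷-⊆ x⊆T)))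

∈-subsets⁻ : ∀ {m} {T x : Subset m} → x ∈ₗ subsets T → x ⊆ T
∈-subsets⁻ {T = []}          (here refl) = λ ()
∈-subsets⁻ {T = outside ∷ T} p with ∈-map⁻ (outside ∷_) p
... | _ , q , refl = out⊆ (∈-subsets⁻ q)
∈-subsets⁻ {T = inside ∷ T}  p with ∈-++⁻ (map (outside ∷_) (subsets T)) p
... | inj₁ p′ with _ , q , refl ← ∈-map⁻ (outside ∷_) p′ = out⊆ (∈-subsets⁻ q)
... | inj₂ p′ with _ , q , refl ← ∈-map⁻ (inside ∷_) p′  = in⊆in (∈-subsets⁻ q)

module _ {A : Set} where

  remove : ∀ {x : A} {ys : List A} → x ∈ₗ ys → List A
  remove {ys = _ ∷ ys} (here _)  = ys
  remove {ys = y ∷ _}  (there p) = y ∷ remove p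

  length-remove : ∀ {x : A} {ys : List A} (p : x ∈ₗ ys) → length ys ≡ suc (length (remove p))
  length-remove (here _)  = refl
  length-remove (there p) = cong suc (length-remove p)

  ∈-remove : ∀ {x y : A} {ys : List A} (p : x ∈ₗ ys) → y ∈ₗ ys → y ≢ x → y ∈ₗ remove p
  ∈-remove (here refl) (here refl) y≢x = ⊥-elim (y≢x refl)
  ∈-remove (here _)    (there q)   _   = q
  ∈-remove (there p)   (here y≡)   _   = here y≡
  ∈-remove (there p)   (there q)   y≢x = there (∈-remove p q y≢x)

  length-≤ : {xs ys : List A} → Unique xs → (∀ {x} → x ∈ₗ xs → x ∈ₗ ys) → length xs ≤ length ys
  length-≤ {[]}     _           _     = z≤n
  length-≤ {x ∷ xs} (x∉xs ∷ u) xs⊆ys = subst (suc (length xs) ≤_) (sym (length-remove x∈ys))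
    (s≤s (length-≤ u (λ y∈xs → ∈-remove x∈ys (xs⊆ys (there y∈xs)) (λ y≡x → lookupᴬ x∉xs y∈xs (sym y≡x)))))
    where x∈ys = xs⊆ys (here refl)

length-cartesianProductWith : ∀ {A B C : Set} (f : A → B → C) (xs : List A) (ys : List B) →
                              length (cartesianProductWith f xs ys) ≡ length xs * length ys
length-cartesianProductWith f []       ys = refl
length-cartesianProductWith f (x ∷ xs) ys = trans (length-++ (map (f x) ys))
  (cong₂ _+_ (length-map (f x) ys) (length-cartesianProductWith f xs ys))

2^-cancel-≤ : ∀ {a b} → 2 ^ a ≤ 2 ^ b → a ≤ b
2^-cancel-≤ 2^a≤2^b = ≮⇒≥ (λ b<a → <⇒≱ (^-monoʳ-< 2 (s≤s (s≤s z≤n)) b<a) 2^a≤2^b)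

_≟ᵥ_ : ∀ {m} (x y : Subset m) → Dec (x ≡ y)
_≟ᵥ_ = ≡-dec _≟ᴮ_

module _ {m : ℕ} where

  combos : ∀ {k} → (Fin k → Subset m) → List (Subset m)
  combos {k} f = map (λ c → combo (lookup c) f) (subsets (⊤ {k}))

  length-combos : ∀ {k} (f : Fin k → Subset m) → length (combos f) ≡ 2 ^ k
  length-combos {k} f = trans (length-map _ (subsets (⊤ {k})))
                              (trans (length-subsets (⊤ {k})) (cong (2 ^_) (∣⊤∣≡n k)))

  ∈-combos⁺ : ∀ {k} {f : Fin k → Subset m} {y} → Span f y → y ∈ₗ combos f
  ∈-combos⁺ {f = f} (c , refl) = subst (_∈ₗ combos f) (combo-cong f (lookup∘tabulate c))
                                       (∈-map⁺ (λ c → combo (lookup c) f) (∈-subsets⁺ {x = tabulate c} ⊆⊤))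

  ∈-combos⁻ : ∀ {k} {f : Fin k → Subset m} {y} → y ∈ₗ combos f → Span f y
  ∈-combos⁻ {f = f} y∈ with c , _ , refl ← ∈-map⁻ (λ c → combo (lookup c) f) y∈ = lookup c , refl

  combos-unique : ∀ {k} (f : Fin k → Subset m) → LinIndep f → Unique (combos f)
  combos-unique f f-ind = Unique.map⁺ injective (subsets-unique ⊤)
    where
      injective : ∀ {a b} → combo (lookup a) f ≡ combo (lookup b) f → a ≡ b
      injective {a} {b} eq = lookup-ext λ i → xor≡false⇒≡ (f-ind (λ j → lookup a j xor lookup b j)
        (trans (combo-xor (lookup a) (lookup b) f) (trans (cong (_⊕ _) eq) (⊕-self _))) i)

  2^≤length : ∀ {k} {f : Fin k → Subset m} {ys : List (Subset m)} →
              LinIndep f → (∀ c → combo c f ∈ₗ ys) → 2 ^ k ≤ length ys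
  2^≤length {f = f} {ys} f-ind combos∈ys = subst (_≤ length ys) (length-combos f)
    (length-≤ (combos-unique f f-ind) (λ y∈ → let c , y≡ = ∈-combos⁻ y∈ in subst (_∈ₗ ys) y≡ (combos∈ys c)))

  independent≤spanning : ∀ {k p} {f : Fin k → Subset m} (g : Fin p → Subset m) →
                         LinIndep f → (∀ i → Span g (f i)) → k ≤ p
  independent≤spanning g f-ind f∈g = 2^-cancel-≤ (subst (_ ≤_) (length-combos g)
    (2^≤length f-ind (λ c → ∈-combos⁺ (Span-combo g f∈g c))))

  independent⊆⇒≤∣∣ : ∀ {k} {f : Fin k → Subset m} {T : Subset m} →
                     LinIndep f → (∀ i → f i ⊆ T) → k ≤ ∣ T ∣
  independent⊆⇒≤∣∣ {f = f} {T} f-ind f⊆T = 2^-cancel-≤ (subst (_ ≤_) (length-subsets T)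
    (2^≤length f-ind (λ c → ∈-subsets⁺ (combo-closed (⊆-isSubspace T) c f (λ i _ → f⊆T i)))))

  dim-unique : ∀ {P : Subset m → Set} {d d′} → HasDim P d → HasDim P d′ → d ≡ d′
  dim-unique (f , f-ind , f∈P , f-span) (g , g-ind , g∈P , g-span) =
    ≤-antisym (independent≤spanning g f-ind (λ i → g-span _ (f∈P i)))
              (independent≤spanning f g-ind (λ i → f-span _ (g∈P i)))

  -- Each y ⊆ T is s ⊕ z with s among the 2^k combinations of f and z among the 2^∣F∣ subsets of F.
  ∣T∣≤dim+∣F∣ : ∀ {k} {P : Subset m → Set} (f : Fin k → Subset m) → IsSubspace P → (∀ y → P y → Span f y) →
                (T F : Subset m) → (∀ {e} → e ∈ T → (P +ˢ (_⊆ F)) ⁅ e ⁆) → ∣ T ∣ ≤ k + ∣ F ∣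
  ∣T∣≤dim+∣F∣ {k} {P} f P-sub P⊆f T F units∈ = 2^-cancel-≤ (subst₂ _≤_ (length-subsets T)
    (trans (length-cartesianProductWith _⊕_ (combos f) (subsets F))
           (trans (cong₂ _*_ (length-combos f) (length-subsets F)) (sym (^-distribˡ-+-* 2 k ∣ F ∣))))
    (length-≤ (subsets-unique T) decompose))
    where
      decompose : ∀ {y} → y ∈ₗ subsets T → y ∈ₗ cartesianProductWith _⊕_ (combos f) (subsets F)
      decompose {y} y∈ with s , z , s∈P , z⊆F , refl ←
        units-closed (+-isSubspace P-sub (⊆-isSubspace F)) y (λ e∈y → units∈ (∈-subsets⁻ y∈ e∈y))
        = ∈-cartesianProductWith⁺ _⊕_ (∈-combos⁺ (P⊆f s s∈P)) (∈-subsets⁺ z⊆F)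

  Span? : ∀ {k} (f : Fin k → Subset m) y → Dec (Span f y)
  Span? f y = map′ (λ (c , eq) → lookup c , eq)
                   (λ (c , eq) → tabulate c , trans (combo-cong f (lookup∘tabulate c)) eq)
                   (anySubset? (λ c → combo (lookup c) f ≟ᵥ y))

  +-dec : {P Q : Subset m → Set} → (∀ x → Dec (P x)) → (∀ x → Dec (Q x)) → ∀ x → Dec ((P +ˢ Q) x)
  +-dec {P} {Q} P? Q? x = map′
    (λ (y , py , qz) → y , y ⊕ x , py , qz , sym (⊕-cancelˡ y x))
    (λ { (y , z , py , qz , refl) → y , py , subst Q (sym (⊕-cancelˡ y z)) qz })
    (anySubset? (λ y → P? y ×-dec Q? (y ⊕ x)))

  Span-∷ : ∀ {d} (x : Subset m) {f : Fin d → Subset m} {y} → Span f y → Span (x Vector.∷ f) y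
  Span-∷ x (c , refl) = false Vector.∷ c , ⊕-identityˡ _

  LinIndep-∷ : ∀ {d} {x : Subset m} {f : Fin d → Subset m} → LinIndep f → ¬ Span f x → LinIndep (x Vector.∷ f)
  LinIndep-∷ {x = x} {f} f-ind x∉f c sum≡⊥ with c zero in c₀
  ... | true  = ⊥-elim (x∉f (c ∘ suc , sym (⊕≡⊥⇒≡ sum≡⊥)))
  ... | false = λ { zero → c₀ ; (suc i) → f-ind (c ∘ suc) (trans (sym (⊕-identityˡ _)) sum≡⊥) i }

  greedy-basis : {P : Subset m → Set} → (∀ x → Dec (P x)) → (xs : List (Subset m)) →
    Σ ℕ λ d → Σ (Fin d → Subset m) λ f → LinIndep f × (∀ i → P (f i)) × (∀ {x} → x ∈ₗ xs → P x → Span f x)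
  greedy-basis P? [] = 0 , (λ ()) , (λ _ _ ()) , (λ ()) , λ ()
  greedy-basis P? (x ∷ xs) with greedy-basis P? xs
  ... | d , f , f-ind , f∈P , f-span with P? x | Span? f x
  ...   | no x∉P | _ = d , f , f-ind , f∈P , λ { (here refl) x∈P → ⊥-elim (x∉P x∈P) ; (there y∈) → f-span y∈ }
  ...   | yes _  | yes x∈f = d , f , f-ind , f∈P , λ { (here refl) _ → x∈f ; (there y∈) → f-span y∈ }
  ...   | yes x∈P | no x∉f = suc d , x Vector.∷ f , LinIndep-∷ f-ind x∉f ,
    (λ { zero → x∈P ; (suc i) → f∈P i }) ,
    λ { (here refl) _ → Span-gen (x Vector.∷ f) zero ; (there y∈) y∈P → Span-∷ x (f-span y∈ y∈P) }

  dim-exists : {P : Subset m → Set} → (∀ x → Dec (P x)) → ∃ (HasDim P)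
  dim-exists P? with d , f , f-ind , f∈P , f-span ← greedy-basis P? (subsets ⊤) =
    d , f , f-ind , f∈P , λ x x∈P → f-span (∈-subsets⁺ ⊆⊤) x∈P

↑ˡ↑ʳ-elim : ∀ {d q} {P : Fin (d + q) → Set} → (∀ j → P (j ↑ˡ q)) → (∀ j → P (d ↑ʳ j)) → ∀ i → P i
↑ˡ↑ʳ-elim {d} {q} {P} Pˡ Pʳ i with splitAt d i in eq
... | inj₁ j = subst P (splitAt⁻¹-↑ˡ eq) (Pˡ j)
... | inj₂ j = subst P (splitAt⁻¹-↑ʳ eq) (Pʳ j)

++-suc : ∀ {A : Set} {d q} (f : Fin (suc d) → A) (g : Fin q → A) (i : Fin (d + q)) →
         (f ++ g) (suc i) ≡ ((f ∘ suc) ++ g) i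
++-suc {d = d} f g i with splitAt d i
... | inj₁ j = refl
... | inj₂ j = refl

module _ {m : ℕ} where

  combo-++ : ∀ {d q} (c : Fin (d + q) → Bool) (f : Fin d → Subset m) (g : Fin q → Subset m) →
             combo c (f ++ g) ≡ combo (c ∘ (_↑ˡ q)) f ⊕ combo (c ∘ (d ↑ʳ_)) g
  combo-++ {zero}  c f g = sym (⊕-identityˡ _)
  combo-++ {suc d} c f g = trans
    (cong (scale (c zero) (f zero) ⊕_)
          (trans (combo-congʳ (c ∘ suc) (++-suc f g)) (combo-++ (c ∘ suc) (f ∘ suc) g)))
    (sym (⊕-assoc _ _ _))

  combo-++-++ : ∀ {d q} (a : Fin d → Bool) (b : Fin q → Bool) (f : Fin d → Subset m) (g : Fin q → Subset m) →
                combo (a ++ b) (f ++ g) ≡ combo a f ⊕ combo b g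
  combo-++-++ a b f g = trans (combo-++ (a ++ b) f g)
    (cong₂ _⊕_ (combo-cong f (lookup-++ˡ a b)) (combo-cong g (lookup-++ʳ a b)))

  ++-independent : ∀ {d q} {f : Fin d → Subset m} {g : Fin q → Subset m} → LinIndep f →
                   (∀ a b → combo a f ⊕ combo b g ≡ ⊥ → ∀ j → b j ≡ false) → LinIndep (f ++ g)
  ++-independent {d} {q} {f} {g} f-ind g-coeffs c c≡⊥ = ↑ˡ↑ʳ-elim cᶠ≡false cᵍ≡false
    where
      cᶠ = c ∘ (_↑ˡ q)
      cᵍ = c ∘ (d ↑ʳ_)
      split≡⊥ : combo cᶠ f ⊕ combo cᵍ g ≡ ⊥
      split≡⊥ = trans (sym (combo-++ c f g)) c≡⊥
      cᵍ≡false = g-coeffs cᶠ cᵍ split≡⊥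
      cᶠ≡false = f-ind cᶠ (trans (⊕≡⊥⇒≡ split≡⊥) (trans (combo-cong g cᵍ≡false) (combo-false g)))

  HasDim-cong : ∀ {P Q : Subset m → Set} {d} → (∀ {x} → P x → Q x) → (∀ {x} → Q x → P x) →
                HasDim P d → HasDim Q d
  HasDim-cong P⇒Q Q⇒P (f , f-ind , f∈P , f-span) = f , f-ind , P⇒Q ∘ f∈P , λ x x∈Q → f-span x (Q⇒P x∈Q)

  Ker : (Subset m → Subset m) → Subset m → Set
  Ker L x = L x ≡ ⊥

  Im : (Subset m → Subset m) → (Subset m → Set) → Subset m → Set
  Im L P y = ∃ λ x → P x × L x ≡ y

  Im-dec : ∀ {P : Subset m → Set} (L : Subset m → Subset m) → (∀ x → Dec (P x)) → ∀ y → Dec (Im L P y)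
  Im-dec L P? y = anySubset? (λ x → P? x ×-dec (L x ≟ᵥ y))

  Ker-isSubspace : (L : Subset m → Subset m) → (∀ x y → L (x ⊕ y) ≡ L x ⊕ L y) → IsSubspace (Ker L)
  Ker-isSubspace L L-⊕ = record
    { ⊥-closed = additive-⊥ L L-⊕
    ; ⊕-closed = λ Lx≡⊥ Ly≡⊥ → trans (L-⊕ _ _) (trans (cong₂ _⊕_ Lx≡⊥ Ly≡⊥) (⊕-self ⊥))
    }

  -- A basis of P ∩ Ker L followed by lifts of a basis of L(P) is a basis of P.
  dim-ker+im : ∀ {P : Subset m → Set} {L : Subset m → Subset m} → IsSubspace P →
               (∀ x y → L (x ⊕ y) ≡ L x ⊕ L y) →
               ∀ {q r} → HasDim (P ∩ˢ Ker L) q → HasDim (Im L P) r → HasDim P (q + r)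
  dim-ker+im {P} {L} P-sub L-⊕ {q} {r} (a , a-ind , a∈ , a-span) (u , u-ind , u∈ , u-span) =
    a ++ w , ++-independent a-ind w-coeffs≡false , basis∈P , spanning
    where
      w : Fin r → Subset m
      w j = proj₁ (u∈ j)

      w∈P : ∀ j → P (w j)
      w∈P j = proj₁ (proj₂ (u∈ j))

      L-combo-w : ∀ β → L (combo β w) ≡ combo β u
      L-combo-w β = trans (additive-combo L L-⊕ β w) (combo-congʳ β (λ j → proj₂ (proj₂ (u∈ j))))

      L-combo-a : ∀ α → L (combo α a) ≡ ⊥
      L-combo-a α = combo-closed (Ker-isSubspace L L-⊕) α a (λ i _ → proj₂ (a∈ i))

      w-coeffs≡false : ∀ α β → combo α a ⊕ combo β w ≡ ⊥ → ∀ j → β j ≡ false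
      w-coeffs≡false α β sum≡⊥ = u-ind β (begin
        combo β u                      ≡⟨ L-combo-w β ⟨
        L (combo β w)                  ≡⟨ ⊕-identityˡ _ ⟨
        ⊥ ⊕ L (combo β w)              ≡⟨ cong (_⊕ L (combo β w)) (L-combo-a α) ⟨
        L (combo α a) ⊕ L (combo β w)  ≡⟨ L-⊕ _ _ ⟨
        L (combo α a ⊕ combo β w)      ≡⟨ cong L sum≡⊥ ⟩
        L ⊥                            ≡⟨ additive-⊥ L L-⊕ ⟩
        ⊥                              ∎)
        where open ≡-Reasoning

      basis∈P : ∀ i → P ((a ++ w) i)
      basis∈P = ↑ˡ↑ʳ-elim (λ j → subst P (sym (lookup-++ˡ a w j)) (proj₁ (a∈ j)))
                          (λ j → subst P (sym (lookup-++ʳ a w j)) (w∈P j))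

      spanning : ∀ y → P y → Span (a ++ w) y
      spanning y y∈P = α ++ β , trans (combo-++-++ α β a w) y≡
        where
          β = proj₁ (u-span (L y) (y , y∈P , refl))
          y′ = y ⊕ combo β w
          y′∈P∩Ker : (P ∩ˢ Ker L) y′
          y′∈P∩Ker = ⊕-closed P-sub y∈P (combo-closed P-sub β w (λ j _ → w∈P j)) ,
            trans (L-⊕ _ _) (trans (cong (L y ⊕_) (trans (L-combo-w β) (proj₂ (u-span (L y) (y , y∈P , refl)))))
                                   (⊕-self (L y)))
          α = proj₁ (a-span y′ y′∈P∩Ker)
          y≡ : combo α a ⊕ combo β w ≡ y
          y≡ = trans (cong (_⊕ combo β w) (proj₂ (a-span y′ y′∈P∩Ker))) (⊕-cancelʳ y (combo β w))

  ∣T∣≤dim : ∀ {k} {P : Subset m → Set} (f : Fin k → Subset m) → IsSubspace P → (∀ y → P y → Span f y) →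
            (T : Subset m) → (∀ {e} → e ∈ T → P ⁅ e ⁆) → ∣ T ∣ ≤ k
  ∣T∣≤dim {k} f P-sub P⊆f T units∈P = subst (∣ T ∣ ≤_) (trans (cong (k +_) (∣⊥∣≡0 m)) (+-identityʳ k))
    (∣T∣≤dim+∣F∣ f P-sub P⊆f T ⊥ (λ e∈T → ⁅ _ ⁆ , ⊥ , units∈P e∈T , ⊥⊆ , sym (⊕-identityʳ _)))

  +⊆-intro : ∀ {P : Subset m → Set} {s y F} → P s → s ⊕ y ⊆ F → (P +ˢ (_⊆ F)) y
  +⊆-intro {s = s} {y} s∈P s⊕y⊆F = s , s ⊕ y , s∈P , s⊕y⊆F , sym (⊕-cancelˡ s y)

  dim-⊆ : ∀ {T : Subset m} {d} → HasDim (_⊆ T) d → d ≡ ∣ T ∣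
  dim-⊆ {T} (f , f-ind , f⊆T , f-span) =
    ≤-antisym (independent⊆⇒≤∣∣ f-ind f⊆T) (∣T∣≤dim f (⊆-isSubspace T) f-span T ⁅⁆⊆)

-- Cut space and cycle sums

∨≡xor : ∀ a b → (a ≡ true → b ≡ true → Empty) → a ∨ b ≡ a xor b
∨≡xor false b _ = refl
∨≡xor true false _ = refl
∨≡xor true true  both = ⊥-elim (both refl refl)

telescope : ∀ {k} (p : Fin (suc k) → Bool) →
            sum (λ (i : Fin k) → p (inject₁ i) xor p (suc i)) ≡ p zero xor p (fromℕ k)
telescope {zero}  p = sym (xor-same (p zero))
telescope {suc k} p = begin
  (p zero xor p (suc zero)) xor sum (λ i → p (suc (inject₁ i)) xor p (suc (suc i)))
    ≡⟨ cong ((p zero xor p (suc zero)) xor_) (telescope (p ∘ suc)) ⟩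
  (p zero xor p (suc zero)) xor (p (suc zero) xor p (fromℕ (suc k)))
    ≡⟨ xor-assoc (p zero) _ _ ⟩
  p zero xor (p (suc zero) xor (p (suc zero) xor p (fromℕ (suc k))))
    ≡⟨ cong (p zero xor_) (trans (sym (xor-assoc (p (suc zero)) (p (suc zero)) _))
                                 (cong (_xor p (fromℕ (suc k))) (xor-same (p (suc zero))))) ⟩
  p zero xor p (fromℕ (suc k)) ∎
  where open ≡-Reasoning

module _ {n m : ℕ} (G : Graph n m) where

  IsEnd : Fin m → Fin n → Set
  IsEnd e v = proj₁ (ends G e) ≡ v ⊎ proj₂ (ends G e) ≡ v

  joins-ends : ∀ {e a b} → Joins G e a b → IsEnd e a × IsEnd e b
  joins-ends (inj₁ refl) = inj₁ refl , inj₂ refl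
  joins-ends (inj₂ refl) = inj₂ refl , inj₁ refl

  end-of-joins : ∀ {e a b v} → Joins G e a b → IsEnd e v → v ≡ a ⊎ v ≡ b
  end-of-joins (inj₁ refl) (inj₁ refl) = inj₁ refl
  end-of-joins (inj₁ refl) (inj₂ refl) = inj₂ refl
  end-of-joins (inj₂ refl) (inj₁ refl) = inj₂ refl
  end-of-joins (inj₂ refl) (inj₂ refl) = inj₁ refl

  ∈E⇒IsEnd : ∀ {e v} → e ∈ E[_] G v → IsEnd e v
  ∈E⇒IsEnd {e} {v} e∈E with proj₁ (ends G e) ≟ v | proj₂ (ends G e) ≟ v
                          | trans (sym (lookup∘tabulate (λ e → incident G e v) e)) (∈⇒lookup e∈E)
  ... | yes a≡v | _       | _ = inj₁ a≡v
  ... | no _    | yes b≡v | _ = inj₂ b≡v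

  IsEnd⇒∈E : ∀ {e v} → IsEnd e v → e ∈ E[_] G v
  IsEnd⇒∈E {e} {v} end = lookup⇒∈ (trans (lookup∘tabulate (λ e → incident G e v) e) (incident≡true end))
    where
      incident≡true : IsEnd e v → incident G e v ≡ true
      incident≡true (inj₁ a≡v) with proj₁ (ends G e) ≟ v
      ... | yes _  = refl
      ... | no a≢v = ⊥-elim (a≢v a≡v)
      incident≡true (inj₂ b≡v) with proj₂ (ends G e) ≟ v
      ... | yes _  = ∨-zeroʳ _
      ... | no b≢v = ⊥-elim (b≢v b≡v)

  lookup-vertexVec : ∀ v e → lookup (vertexVec G v) e ≡ δ (proj₁ (ends G e)) v xor δ (proj₂ (ends G e)) v
  lookup-vertexVec v e = trans (lookup∘tabulate _ e) (incidence (proj₁ (ends G e)) (proj₂ (ends G e)))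
    where
      incidence : ∀ a b → (⌊ a ≟ v ⌋ ∨ ⌊ b ≟ v ⌋) ∧ not ⌊ a ≟ b ⌋ ≡ δ a v xor δ b v
      incidence a b rewrite ⌊≟⌋≡δ a v | ⌊≟⌋≡δ b v | ⌊≟⌋≡δ a b with a ≟ b
      ... | yes refl rewrite δ-refl a = trans (∧-zeroʳ _) (sym (xor-same (δ a v)))
      ... | no a≢b   rewrite δ-≢ a≢b  = trans (∧-identityʳ _)
        (∨≡xor (δ a v) (δ b v) (λ av bv → a≢b (trans (δ≡true⇒≡ av) (sym (δ≡true⇒≡ bv)))))

  -- S is the cut space: cut R consists of the edges with exactly one end in R (loops never).
  cut : Subset n → Subset m
  cut R = combo (lookup R) (vertexVec G)

  lookup-cut : ∀ R e → lookup (cut R) e ≡ lookup R (proj₁ (ends G e)) xor lookup R (proj₂ (ends G e))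
  lookup-cut R e = begin
    lookup (cut R) e
      ≡⟨ lookup-combo (lookup R) (vertexVec G) e ⟩
    sum (λ v → lookup R v ∧ lookup (vertexVec G v) e)
      ≡⟨ sum-cong-≗ (λ v → trans (cong (lookup R v ∧_) (lookup-vertexVec v e))
                                 (∧-distribˡ-xor (lookup R v) _ _)) ⟩
    sum (λ v → (lookup R v ∧ δ a v) xor (lookup R v ∧ δ b v))
      ≡⟨ ∑-distrib-+ (λ v → lookup R v ∧ δ a v) (λ v → lookup R v ∧ δ b v) ⟩
    sum (λ v → lookup R v ∧ δ a v) xor sum (λ v → lookup R v ∧ δ b v)
      ≡⟨ cong₂ _xor_ (sum-δ′ a) (sum-δ′ b) ⟩
    lookup R a xor lookup R b ∎
    where
      open ≡-Reasoning
      a = proj₁ (ends G e)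
      b = proj₂ (ends G e)
      sum-δ′ : ∀ c → sum (λ v → lookup R v ∧ δ c v) ≡ lookup R c
      sum-δ′ c = trans (sum-cong-≗ (λ v → cong (lookup R v ∧_) (δ-sym c v))) (sum-δ (lookup R) c)

  vertexVec-joins : ∀ {e a b} v → Joins G e a b → lookup (vertexVec G v) e ≡ δ a v xor δ b v
  vertexVec-joins {e} v (inj₁ ends≡) =
    trans (lookup-vertexVec v e) (cong (λ p → δ (proj₁ p) v xor δ (proj₂ p) v) ends≡)
  vertexVec-joins {e} {a} {b} v (inj₂ ends≡) =
    trans (lookup-vertexVec v e)
          (trans (cong (λ p → δ (proj₁ p) v xor δ (proj₂ p) v) ends≡) (xor-comm (δ b v) (δ a v)))

  cycleSum : Cycle G → Subset m → Bool
  cycleSum c y = sum (λ i → lookup y (edges c i))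

  cycleSum-⊕ : ∀ c x y → cycleSum c (x ⊕ y) ≡ cycleSum c x xor cycleSum c y
  cycleSum-⊕ c x y = trans (sum-cong-≗ (λ i → lookup-⊕ x y (edges c i)))
                           (∑-distrib-+ (λ i → lookup x (edges c i)) (λ i → lookup y (edges c i)))

  cycleSum-kernel : ∀ c → IsSubspace (λ y → cycleSum c y ≡ false)
  cycleSum-kernel c = functional-kernel (cycleSum c) (cycleSum-⊕ c)

  cycleSum-vertexVec : ∀ c v → cycleSum c (vertexVec G v) ≡ false
  cycleSum-vertexVec c v = begin
    cycleSum c (vertexVec G v)
      ≡⟨ sum-init-last (λ i → lookup (vertexVec G v) (edges c i)) ⟩
    sum (λ i → lookup (vertexVec G v) (edges c (inject₁ i))) xor lookup (vertexVec G v) (edges c (fromℕ (k c)))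
      ≡⟨ cong₂ _xor_ (trans (sum-cong-≗ (λ i → vertexVec-joins v (joins-step c i))) (telescope p))
                     (vertexVec-joins v (joins-close c)) ⟩
    (p zero xor p (fromℕ (k c))) xor (p (fromℕ (k c)) xor p zero)
      ≡⟨ cong ((p zero xor p (fromℕ (k c))) xor_) (xor-comm (p (fromℕ (k c))) (p zero)) ⟩
    (p zero xor p (fromℕ (k c))) xor (p zero xor p (fromℕ (k c)))
      ≡⟨ xor-same (p zero xor p (fromℕ (k c))) ⟩
    false ∎
    where
      open ≡-Reasoning
      p : Fin (suc (k c)) → Bool
      p i = δ (verts c i) v

  cycleSum-S : ∀ c {y} → S G y → cycleSum c y ≡ false
  cycleSum-S c (coeffs , refl) =
    combo-closed (cycleSum-kernel c) coeffs (vertexVec G) (λ v _ → cycleSum-vertexVec c v)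

  cycleSum-own-edge : ∀ c j → cycleSum c ⁅ edges c j ⁆ ≡ true
  cycleSum-own-edge c j = trans
    (sum-cong-≗ (λ i → trans (lookup-⁅⁆ (edges c j) (edges c i))
                             (trans (δ-injective (edges-distinct c) j i) (δ-sym j i))))
    (sum-δ (λ _ → true) j)
    where
      δ-injective : ∀ {k} {f : Fin k → Fin m} → (∀ i j → f i ≡ f j → i ≡ j) → ∀ i j → δ (f i) (f j) ≡ δ i j
      δ-injective {f = f} f-inj i j with i ≟ j
      ... | yes refl = trans (δ-refl (f i)) (sym (δ-refl i))
      ... | no i≢j   = trans (δ-≢ (i≢j ∘ f-inj i j)) (sym (δ-≢ i≢j))

  cycleSum-foreign-edge : ∀ c {x} → (∀ i → edges c i ≢ x) → cycleSum c ⁅ x ⁆ ≡ false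
  cycleSum-foreign-edge c {x} x∉c = sum-false _ (λ i → trans (lookup-⁅⁆ x (edges c i)) (δ-≢ (x∉c i ∘ sym)))

  cycle-edge∉S : ∀ {x} → (Σ (Cycle G) λ c → ContainsEdge G c x) → ¬ S G ⁅ x ⁆
  cycle-edge∉S (c , j , refl) x∈S = true≢false (trans (sym (cycleSum-own-edge c j)) (cycleSum-S c x∈S))

-- Cycles through an edge versus cuts

module _ {A : Set} where

  snoc : ∀ {L} → (Fin L → A) → A → Fin (suc L) → A
  snoc {zero}  f a zero    = a
  snoc {suc L} f a zero    = f zero
  snoc {suc L} f a (suc i) = snoc (f ∘ suc) a i

  snoc-inject₁ : ∀ {L} (f : Fin L → A) a i → snoc f a (inject₁ i) ≡ f i
  snoc-inject₁ {suc L} f a zero    = refl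
  snoc-inject₁ {suc L} f a (suc i) = snoc-inject₁ (f ∘ suc) a i

  snoc-fromℕ : ∀ {L} (f : Fin L → A) a → snoc f a (fromℕ L) ≡ a
  snoc-fromℕ {zero}  f a = refl
  snoc-fromℕ {suc L} f a = snoc-fromℕ (f ∘ suc) a

  cons-injective : ∀ {L} {f : Fin L → A} {a} → (∀ i j → f i ≡ f j → i ≡ j) → (∀ i → f i ≢ a) →
                   ∀ i j → (a Vector.∷ f) i ≡ (a Vector.∷ f) j → i ≡ j
  cons-injective f-inj a∉f zero    zero    _  = refl
  cons-injective f-inj a∉f zero    (suc j) eq = ⊥-elim (a∉f j (sym eq))
  cons-injective f-inj a∉f (suc i) zero    eq = ⊥-elim (a∉f i eq)
  cons-injective f-inj a∉f (suc i) (suc j) eq = cong suc (f-inj i j eq)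

  snoc-injective : ∀ {L} {f : Fin L → A} {a} → (∀ i j → f i ≡ f j → i ≡ j) → (∀ i → f i ≢ a) →
                   ∀ i j → snoc f a i ≡ snoc f a j → i ≡ j
  snoc-injective {f = f} {a} f-inj a∉f i j eq with view i | view j
  ... | ‵fromℕ       | ‵fromℕ       = refl
  ... | ‵fromℕ       | ‵inject₁ j′  =
    ⊥-elim (a∉f j′ (trans (sym (snoc-inject₁ f a j′)) (trans (sym eq) (snoc-fromℕ f a))))
  ... | ‵inject₁ i′  | ‵fromℕ       =
    ⊥-elim (a∉f i′ (trans (sym (snoc-inject₁ f a i′)) (trans eq (snoc-fromℕ f a))))
  ... | ‵inject₁ i′  | ‵inject₁ j′  =
    cong inject₁ (f-inj i′ j′ (trans (sym (snoc-inject₁ f a i′)) (trans eq (snoc-inject₁ f a j′))))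

-- Grow the set R of vertices reachable from one end a₀ of x along allowed edges (∉ F, ≠ x). If the other
-- end b₀ is reached, the path closes up with x into a cycle; otherwise no allowed edge crosses R, and the
-- cut of R contains x and, outside F, nothing else.
module _ {n m : ℕ} (G : Graph n m) (F : Subset m) (x : Fin m) where

  private
    a₀ = proj₁ (ends G x)
    b₀ = proj₂ (ends G x)

    Allowed : Fin m → Set
    Allowed e = e ∉ F × e ≢ x

    record Path (R : Subset n) (t : Fin n) : Set where
      field
        len         : ℕ
        vs          : Fin (suc len) → Fin n
        es          : Fin len → Fin m
        vs-start    : vs zero ≡ t
        vs-end      : vs (fromℕ len) ≡ a₀
        es-joins    : ∀ i → Joins G (es i) (vs (inject₁ i)) (vs (suc i))
        vs-distinct : ∀ i j → vs i ≡ vs j → i ≡ j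
        es-distinct : ∀ i j → es i ≡ es j → i ≡ j
        es-allowed  : ∀ i → Allowed (es i)
        vs∈R        : ∀ i → vs i ∈ R

    open Path

    trivial : Path ⁅ a₀ ⁆ a₀
    trivial = record
      { len = 0 ; vs = λ _ → a₀ ; es = λ () ; vs-start = refl ; vs-end = refl ; es-joins = λ ()
      ; vs-distinct = λ { zero zero _ → refl } ; es-distinct = λ () ; es-allowed = λ ()
      ; vs∈R = λ _ → x∈⁅x⁆ a₀ }

    weaken : ∀ {R R′ t} → R ⊆ R′ → Path R t → Path R′ t
    weaken R⊆R′ p = record
      { len = len p ; vs = vs p ; es = es p ; vs-start = vs-start p ; vs-end = vs-end p ; es-joins = es-joins p
      ; vs-distinct = vs-distinct p ; es-distinct = es-distinct p ; es-allowed = es-allowed p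
      ; vs∈R = R⊆R′ ∘ vs∈R p }

    extend : ∀ {R t u e} → Path R t → u ∉ R → Allowed e → Joins G e u t → Path (R ∪ ⁅ u ⁆) u
    extend {R} {t} {u} {e} p u∉R e-allowed e-joins = record
      { len = suc (len p)
      ; vs = u Vector.∷ vs p
      ; es = e Vector.∷ es p
      ; vs-start = refl
      ; vs-end = vs-end p
      ; es-joins = λ { zero → subst (Joins G e u) (sym (vs-start p)) e-joins ; (suc i) → es-joins p i }
      ; vs-distinct = cons-injective (vs-distinct p) (λ i vᵢ≡u → u∉R (subst (_∈ R) vᵢ≡u (vs∈R p i)))
      ; es-distinct = cons-injective (es-distinct p) new-edge
      ; es-allowed = λ { zero → e-allowed ; (suc i) → es-allowed p i }
      ; vs∈R = λ { zero → x∈p∪q⁺ (inj₂ (x∈⁅x⁆ u)) ; (suc i) → p⊆p∪q ⁅ u ⁆ (vs∈R p i) }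
      }
      where
        new-edge : ∀ i → es p i ≢ e
        new-edge i refl with end-of-joins G (es-joins p i) (proj₁ (joins-ends G e-joins))
        ... | inj₁ u≡vᵢ = u∉R (subst (_∈ R) (sym u≡vᵢ) (vs∈R p (inject₁ i)))
        ... | inj₂ u≡vᵢ₊₁ = u∉R (subst (_∈ R) (sym u≡vᵢ₊₁) (vs∈R p (suc i)))

    close : ∀ {R} → x ∉ F → Path R b₀ → Σ (Cycle G) λ c → ContainsEdge G c x × (∀ i → edges c i ∉ F)
    close x∉F p = cycle , (fromℕ (len p) , snoc-fromℕ (es p) x) , edges∉F
      where
        cycle : Cycle G
        cycle = record
          { k = len p
          ; verts = vs p
          ; edges = snoc (es p) x
          ; verts-distinct = vs-distinct p
          ; edges-distinct = snoc-injective (es-distinct p) (proj₂ ∘ es-allowed p)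
          ; joins-step = λ i → subst (λ e → Joins G e (vs p (inject₁ i)) (vs p (suc i)))
                                     (sym (snoc-inject₁ (es p) x i)) (es-joins p i)
          ; joins-close = subst₂ (λ e v → Joins G e v (vs p zero)) (sym (snoc-fromℕ (es p) x)) (sym (vs-end p))
                                 (subst (Joins G x a₀) (sym (vs-start p)) (inj₁ refl))
          }
        edges∉F : ∀ i → snoc (es p) x i ∉ F
        edges∉F i with view i
        ... | ‵fromℕ      = subst (_∉ F) (sym (snoc-fromℕ (es p) x)) x∉F
        ... | ‵inject₁ j  = subst (_∉ F) (sym (snoc-inject₁ (es p) x j)) (proj₁ (es-allowed p j))

    crossing : Subset n → Fin m → Bool
    crossing R e = lookup R (proj₁ (ends G e)) xor lookup R (proj₂ (ends G e))

    crossing-joins : ∀ R e → crossing R e ≡ true → ∃ λ u → ∃ λ t → u ∉ R × t ∈ R × Joins G e u t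
    crossing-joins R e crosses with lookup R (proj₁ (ends G e)) in ra | lookup R (proj₂ (ends G e)) in rb
    ... | true  | false = _ , _ , lookup≡false⇒∉ rb , lookup⇒∈ ra , inj₂ refl
    ... | false | true  = _ , _ , lookup≡false⇒∉ ra , lookup⇒∈ rb , inj₁ refl

    allowed? : ∀ e → Dec (Allowed e)
    allowed? e = ¬? (e ∈? F) ×-dec ¬? (e ≟ x)

    Explored : Set
    Explored = Σ (Subset n) λ R → a₀ ∈ R × (∀ {t} → t ∈ R → Path R t) × (∀ e → Allowed e → crossing R e ≡ false)

    explore : ∀ R → Acc _⊃_ R → a₀ ∈ R → (∀ {t} → t ∈ R → Path R t) → Explored
    explore R (acc larger) a₀∈R paths with any? (λ e → allowed? e ×-dec (crossing R e ≟ᴮ true))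
    ... | no none = R , a₀∈R , paths , λ e e-allowed → ¬-not (λ crosses → none (e , e-allowed , crosses))
    ... | yes (e , e-allowed , crosses) with u , t , u∉R , t∈R , e-joins ← crossing-joins R e crosses =
      explore (R ∪ ⁅ u ⁆) (larger R⊂R∪u) (p⊆p∪q ⁅ u ⁆ a₀∈R) paths′
      where
        R⊂R∪u : (R ∪ ⁅ u ⁆) ⊃ R
        R⊂R∪u = p⊆p∪q ⁅ u ⁆ , u , x∈p∪q⁺ (inj₂ (x∈⁅x⁆ u)) , u∉R
        paths′ : ∀ {t′} → t′ ∈ R ∪ ⁅ u ⁆ → Path (R ∪ ⁅ u ⁆) t′
        paths′ t′∈ with x∈p∪q⁻ R ⁅ u ⁆ t′∈
        ... | inj₁ t′∈R   = weaken (p⊆p∪q ⁅ u ⁆) (paths t′∈R)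
        ... | inj₂ t′∈⁅u⁆ rewrite x∈⁅y⁆⇒x≡y u t′∈⁅u⁆ = extend (paths t∈R) u∉R e-allowed e-joins

    explored : Explored
    explored = explore ⁅ a₀ ⁆ (⊃-wellFounded ⁅ a₀ ⁆) (x∈⁅x⁆ a₀)
      (λ t∈⁅a₀⁆ → subst (Path ⁅ a₀ ⁆) (sym (x∈⁅y⁆⇒x≡y a₀ t∈⁅a₀⁆)) trivial)

  cycle-or-cut : x ∉ F → (Σ (Cycle G) λ c → ContainsEdge G c x × (∀ i → edges c i ∉ F))
                        ⊎ (∃ λ s → S G s × s ⊕ ⁅ x ⁆ ⊆ F)
  cycle-or-cut x∉F with R , a₀∈R , paths , uncrossed ← explored | b₀ ∈? R
  ... | yes b₀∈R = inj₁ (close x∉F (paths b₀∈R))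
  ... | no b₀∉R  = inj₂ (cut G R , (lookup R , refl) , cut⊕x⊆F)
    where
      cut⊕x[e]≡false : ∀ e → e ∉ F → lookup (cut G R ⊕ ⁅ x ⁆) e ≡ false
      cut⊕x[e]≡false e e∉F with e ≟ x
      ... | yes refl = trans (lookup-⊕ (cut G R) ⁅ x ⁆ x) (cong₂ _xor_
        (trans (lookup-cut G R x) (cong₂ _xor_ (∈⇒lookup a₀∈R) (∉⇒lookup≡false b₀∉R)))
        (trans (lookup-⁅⁆ x x) (δ-refl x)))
      ... | no e≢x   = trans (lookup-⊕ (cut G R) ⁅ x ⁆ e) (cong₂ _xor_
        (trans (lookup-cut G R e) (uncrossed e (e∉F , e≢x)))
        (trans (lookup-⁅⁆ x e) (δ-≢ (e≢x ∘ sym))))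
      cut⊕x⊆F : cut G R ⊕ ⁅ x ⁆ ⊆ F
      cut⊕x⊆F {e} e∈cut⊕x with e ∈? F
      ... | yes e∈F = e∈F
      ... | no e∉F = ⊥-elim (true≢false (trans (sym (∈⇒lookup e∈cut⊕x)) (cut⊕x[e]≡false e e∉F)))

module _ {n m : ℕ} (G : Graph n m) where

  S-isSubspace : IsSubspace (S G)
  S-isSubspace = Span-isSubspace (vertexVec G)

  S? : ∀ y → Dec (S G y)
  S? = Span? (vertexVec G)

  cycle-through : ∀ {x} → ¬ S G ⁅ x ⁆ → Σ (Cycle G) λ c → ContainsEdge G c x
  cycle-through {x} x∉S with cycle-or-cut G ⊥ x ∉⊥
  ... | inj₁ (c , x∈c , _)       = c , x∈c
  ... | inj₂ (s , s∈S , s⊕x⊆⊥) = ⊥-elim (x∉S (subst (S G) (⊕≡⊥⇒≡ (⊆-antisym s⊕x⊆⊥ ⊥⊆)) s∈S))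

  units∈S-or-cycle : (T : Subset m) →
    (∀ {e} → e ∈ T → S G ⁅ e ⁆) ⊎ (∃ λ e → e ∈ T × Σ (Cycle G) λ c → ContainsEdge G c e)
  units∈S-or-cycle T with any? (λ e → e ∈? T ×-dec ¬? (S? ⁅ e ⁆))
  ... | yes (e , e∈T , e∉S) = inj₂ (e , e∈T , cycle-through e∉S)
  ... | no none = inj₁ (λ {e} e∈T → decidable-stable (S? ⁅ e ⁆) (λ e∉S → none (e , e∈T , e∉S)))

  cut-through-unit : (F : Subset m) → ∀ {e} → (∀ c → ContainsEdge G c e → Hits G F c) →
                     ∃ λ s → S G s × s ⊕ ⁅ e ⁆ ⊆ F
  cut-through-unit F {e} hits with e ∈? F
  ... | yes e∈F = ⊥ , ⊥-closed S-isSubspace , subst (_⊆ F) (sym (⊕-identityˡ ⁅ e ⁆)) (⁅⁆⊆ e∈F)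
  ... | no e∉F with cycle-or-cut G F e e∉F
  ...   | inj₂ cut = cut
  ...   | inj₁ (c , e∈c , c∩F≡∅) with i , eᵢ∈F ← hits c e∈c = ⊥-elim (c∩F≡∅ i eᵢ∈F)

  own-edge∉span : ∀ c j {d} {f : Fin d → Subset m} → (∀ i → cycleSum G c (f i) ≡ false) →
                  ¬ Span f ⁅ edges c j ⁆
  own-edge∉span c j {f = f} f⊥c (coeffs , combo≡e) = true≢false (trans (sym (cycleSum-own-edge G c j))
    (trans (cong (cycleSum G c) (sym combo≡e))
           (combo-closed (cycleSum-kernel G c) coeffs f (λ i _ → f⊥c i))))

  -- Adjoin the chosen edge of each cycle in turn: cycleSum c is 1 on c's own edge and 0 on everything
  -- adjoined before, so independence is preserved.
  length+dim≤∣T∣ : ∀ {d} {T : Subset m} (f : Fin d → Subset m) → LinIndep f → (∀ i → f i ⊆ T) →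
                   (cs : List (Cycle G)) → AllPairs (EdgeDisjoint G) cs →
                   All (λ c → ∀ i → cycleSum G c (f i) ≡ false) cs →
                   All (λ c → ∃ λ j → edges c j ∈ T) cs → length cs + d ≤ ∣ T ∣
  length+dim≤∣T∣ f f-ind f⊆T [] [] [] [] = independent⊆⇒≤∣∣ f-ind f⊆T
  length+dim≤∣T∣ {d} {T} f f-ind f⊆T (c ∷ cs) (c-disjoint ∷ disjoint) (f⊥c ∷ f⊥cs) ((j , e∈T) ∷ chosen) =
    subst (_≤ ∣ T ∣) (+-suc (length cs) d)
      (length+dim≤∣T∣ (e-unit Vector.∷ f) (LinIndep-∷ f-ind (own-edge∉span c j f⊥c))
                      (λ { zero → ⁅⁆⊆ e∈T ; (suc i) → f⊆T i })
                      cs disjoint (zipWithᴬ (λ {c′} → annihilates {c′}) (c-disjoint , f⊥cs)) chosen)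
    where
      e-unit : Subset m
      e-unit = ⁅ edges c j ⁆
      annihilates : ∀ {c′} → EdgeDisjoint G c c′ × (∀ i → cycleSum G c′ (f i) ≡ false) →
                    ∀ i → cycleSum G c′ ((e-unit Vector.∷ f) i) ≡ false
      annihilates {c′} (c-c′-disjoint , _) zero = cycleSum-foreign-edge G c′ (λ t eq → c-c′-disjoint j t (sym eq))
      annihilates (_ , f⊥c′) (suc i) = f⊥c′ i

  edge-at-vertex : ∀ {v} c → ContainsVertex G c v → ∃ λ j → edges c j ∈ E[_] G v
  edge-at-vertex c (zero  , refl) = fromℕ (k c) , IsEnd⇒∈E G (proj₂ (joins-ends G (joins-close c)))
  edge-at-vertex c (suc i , refl) = inject₁ i , IsEnd⇒∈E G (proj₂ (joins-ends G (joins-step c i)))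

  edge-joins : ∀ (c : Cycle G) i → ∃ λ a → ∃ λ b → Joins G (edges c i) (verts c a) (verts c b)
  edge-joins c i with view i
  ... | ‵fromℕ     = _ , _ , joins-close c
  ... | ‵inject₁ j = _ , _ , joins-step c j

  vertex-of-edge : ∀ {v e} c → e ∈ E[_] G v → ContainsEdge G c e → ContainsVertex G c v
  vertex-of-edge c e∈E (i , refl) with a , b , joins ← edge-joins c i | end-of-joins G joins (∈E⇒IsEnd G e∈E)
  ... | inj₁ v≡ = a , sym v≡
  ... | inj₂ v≡ = b , sym v≡

  disjoint-cycles≤m∸dimS : ∀ {d} → HasDim (S G) d → (cs : List (Cycle G)) → AllPairs (EdgeDisjoint G) cs →
                           length cs ≤ m ∸ d
  disjoint-cycles≤m∸dimS (b , b-ind , b∈S , _) cs disjoint = m+n≤o⇒m≤o∸n (length cs)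
    (subst (length cs + _ ≤_) (∣⊤∣≡n m)
      (length+dim≤∣T∣ b b-ind (λ _ → ⊆⊤) cs disjoint
        (universal (λ c i → cycleSum-S G c (b∈S i)) cs) (universal (λ c → zero , ∈⊤) cs)))

  m∸dimS≤∣F∣ : ∀ {d} → HasDim (S G) d → (F : Subset m) → (∀ c → Hits G F c) → m ∸ d ≤ ∣ F ∣
  m∸dimS≤∣F∣ {d} (b , _ , _ , b-span) F hits = m≤n+o⇒m∸n≤o m d (subst (_≤ d + ∣ F ∣) (∣⊤∣≡n m)
    (∣T∣≤dim+∣F∣ b S-isSubspace b-span ⊤ F unit∈S+F))
    where
      unit∈S+F : ∀ {e} → e ∈ ⊤ → (S G +ˢ (_⊆ F)) ⁅ e ⁆
      unit∈S+F _ with _ , s∈S , s⊕e⊆F ← cut-through-unit F (λ c _ → hits c) = +⊆-intro s∈S s⊕e⊆F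

  dimS<m⇔cycle : ∀ {d} → HasDim (S G) d → (d < m) ⇔ Cycle G
  dimS<m⇔cycle {d} (b , b-ind , b∈S , b-span) = mk⇔ to from
    where
      to : d < m → Cycle G
      to d<m with units∈S-or-cycle ⊤
      ... | inj₂ (_ , _ , c , _) = c
      ... | inj₁ units∈S = ⊥-elim (<⇒≱ d<m (subst (_≤ d) (∣⊤∣≡n m) (∣T∣≤dim b S-isSubspace b-span ⊤ units∈S)))
      from : Cycle G → d < m
      from c = subst (d <_) (∣⊤∣≡n m)
        (length+dim≤∣T∣ b b-ind (λ _ → ⊆⊤) (c ∷ []) ([] ∷ [])
                        ((λ i → cycleSum-S G c (b∈S i)) ∷ []) ((zero , ∈⊤) ∷ []))

  cycle-through⇔∉S : ∀ x → (Σ (Cycle G) λ c → ContainsEdge G c x) ⇔ (¬ S G ⁅ x ⁆)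
  cycle-through⇔∉S x = mk⇔ (cycle-edge∉S G) cycle-through

module _ {n m : ℕ} (G : Graph n m) (v : Fin n) where

  private
    E : Subset m
    E = E[_] G v

  Z₂E∩S-isSubspace : IsSubspace (Z₂E[_] G v ∩ˢ S G)
  Z₂E∩S-isSubspace = ∩-isSubspace (⊆-isSubspace E) (S-isSubspace G)

  Z₂E+S-isSubspace : IsSubspace (Z₂E[_] G v +ˢ S G)
  Z₂E+S-isSubspace = +-isSubspace (⊆-isSubspace E) (S-isSubspace G)

  disjoint-cycles≤∣E∣∸dim : ∀ {d} → HasDim (Z₂E[_] G v ∩ˢ S G) d → (cs : List (Cycle G)) →
                            All (λ c → ContainsVertex G c v) cs → AllPairs (EdgeDisjoint G) cs →
                            length cs ≤ ∣ E ∣ ∸ d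
  disjoint-cycles≤∣E∣∸dim (b , b-ind , b∈ , _) cs through-v disjoint = m+n≤o⇒m≤o∸n (length cs)
    (length+dim≤∣T∣ G b b-ind (proj₁ ∘ b∈) cs disjoint
      (universal (λ c i → cycleSum-S G c (proj₂ (b∈ i))) cs) (mapᴬ (λ {c} → edge-at-vertex G c) through-v))

  ∣E∣∸dim≤∣F∣ : ∀ {d} → HasDim (Z₂E[_] G v ∩ˢ S G) d → (F : Subset m) → F ⊆ E →
                (∀ c → ContainsVertex G c v → Hits G F c) → ∣ E ∣ ∸ d ≤ ∣ F ∣
  ∣E∣∸dim≤∣F∣ {d} (b , _ , _ , b-span) F F⊆E hits = m≤n+o⇒m∸n≤o ∣ E ∣ d
    (∣T∣≤dim+∣F∣ b Z₂E∩S-isSubspace b-span E F unit∈Z₂E∩S+F)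
    where
      unit∈Z₂E∩S+F : ∀ {e} → e ∈ E → ((Z₂E[_] G v ∩ˢ S G) +ˢ (_⊆ F)) ⁅ e ⁆
      unit∈Z₂E∩S+F {e} e∈E
        with s , s∈S , s⊕e⊆F ← cut-through-unit G F (λ c e∈c → hits c (vertex-of-edge G c e∈E e∈c)) =
        +⊆-intro {P = Z₂E[_] G v ∩ˢ S G}
                 (subst (_⊆ E) (⊕-cancelʳ s ⁅ e ⁆) (⊕-⊆ (F⊆E ∘ s⊕e⊆F) (⁅⁆⊆ e∈E)) , s∈S) s⊕e⊆F

  dim<∣E∣⇔cycle : ∀ {d} → HasDim (Z₂E[_] G v ∩ˢ S G) d → (d < ∣ E ∣) ⇔ (Σ (Cycle G) λ c → ContainsVertex G c v)
  dim<∣E∣⇔cycle {d} (b , b-ind , b∈ , b-span) = mk⇔ to from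
    where
      to : d < ∣ E ∣ → Σ (Cycle G) λ c → ContainsVertex G c v
      to d<∣E∣ with units∈S-or-cycle G E
      ... | inj₂ (e , e∈E , c , e∈c) = c , vertex-of-edge G c e∈E e∈c
      ... | inj₁ units∈S =
        ⊥-elim (<⇒≱ d<∣E∣ (∣T∣≤dim b Z₂E∩S-isSubspace b-span E (λ e∈E → ⁅⁆⊆ e∈E , units∈S e∈E)))
      from : (Σ (Cycle G) λ c → ContainsVertex G c v) → d < ∣ E ∣
      from (c , v∈c) = length+dim≤∣T∣ G b b-ind (proj₁ ∘ b∈) (c ∷ []) ([] ∷ [])
        ((λ i → cycleSum-S G c (proj₂ (b∈ i))) ∷ []) (edge-at-vertex G c v∈c ∷ [])

  -- Rank–nullity for y ↦ y ─ E on S and on Z₂E + S: the images agree; the kernels are Z₂E ∩ S and Z₂E.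
  ∣E∣∸dim∩≡dim+∸dimS : ∀ {d₁ d₂ d₃} → HasDim (S G) d₁ → HasDim (Z₂E[_] G v ∩ˢ S G) d₂ →
                       HasDim (Z₂E[_] G v +ˢ S G) d₃ → ∣ E ∣ ∸ d₂ ≡ d₃ ∸ d₁
  ∣E∣∸dim∩≡dim+∸dimS {d₁} {d₂} {d₃} dim₁ dim₂ dim₃ = begin
    ∣ E ∣ ∸ d₂            ≡⟨ [m+n]∸[m+o]≡n∸o r ∣ E ∣ d₂ ⟨
    (r + ∣ E ∣) ∸ (r + d₂) ≡⟨ cong₂ _∸_ (trans (+-comm r ∣ E ∣) (dim-unique dim-Z₂E+S dim₃))
                                        (trans (+-comm r d₂) (dim-unique dim-S dim₁)) ⟩
    d₃ ∸ d₁               ∎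
    where
      open ≡-Reasoning
      L : Subset m → Subset m
      L y = y ─ E
      L-⊕ : ∀ x y → L (x ⊕ y) ≡ L x ⊕ L y
      L-⊕ x y = ─-⊕ x y E

      dim-image : ∃ (HasDim (Im L (S G)))
      dim-image = dim-exists (Im-dec L (S? G))
      r = proj₁ dim-image

      dim-S : HasDim (S G) (d₂ + r)
      dim-S = dim-ker+im (S-isSubspace G) L-⊕
        (HasDim-cong (λ (x⊆E , x∈S) → x∈S , ⊆⇒─≡⊥ x⊆E) (λ (x∈S , Lx≡⊥) → ─≡⊥⇒⊆ Lx≡⊥ , x∈S) dim₂)
        (proj₂ dim-image)

      dim-Z₂E : HasDim (_⊆ E) ∣ E ∣
      dim-Z₂E with d , basis ← dim-exists (_⊆? E) = subst (HasDim (_⊆ E)) (dim-⊆ basis) basis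

      image-Z₂E+S⇒image-S : ∀ {y} → Im L (Z₂E[_] G v +ˢ S G) y → Im L (S G) y
      image-Z₂E+S⇒image-S (_ , (a , s , a⊆E , s∈S , refl) , refl) =
        s , s∈S , trans (sym (⊕-identityˡ (L s))) (trans (cong (_⊕ L s) (sym (⊆⇒─≡⊥ a⊆E))) (sym (L-⊕ a s)))

      Z₂E⇒Z₂E+S∩Ker : ∀ {x} → x ⊆ E → ((Z₂E[_] G v +ˢ S G) ∩ˢ Ker L) x
      Z₂E⇒Z₂E+S∩Ker {x} x⊆E = (x , ⊥ , x⊆E , ⊥-closed (S-isSubspace G) , sym (⊕-identityʳ x)) , ⊆⇒─≡⊥ x⊆E

      image-S⇒image-Z₂E+S : ∀ {y} → Im L (S G) y → Im L (Z₂E[_] G v +ˢ S G) y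
      image-S⇒image-Z₂E+S (x , x∈S , Lx≡y) = x , (⊥ , x , ⊥⊆ , x∈S , sym (⊕-identityˡ x)) , Lx≡y

      dim-Z₂E+S : HasDim (Z₂E[_] G v +ˢ S G) (∣ E ∣ + r)
      dim-Z₂E+S = dim-ker+im Z₂E+S-isSubspace L-⊕
        (HasDim-cong Z₂E⇒Z₂E+S∩Ker (λ (_ , Lx≡⊥) → ─≡⊥⇒⊆ Lx≡⊥) dim-Z₂E)
        (HasDim-cong image-S⇒image-Z₂E+S image-Z₂E+S⇒image-S (proj₂ dim-image))

corollary1p19 : ∀ {n m : ℕ} (G : Graph n m) →
    ((∃ λ d → HasDim (S G) d) ×
     (∀ d → HasDim (S G) d →
        (∀ (cs : List (Cycle G)) → AllPairs (EdgeDisjoint G) cs → length cs ≤ m ∸ d)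
      × (∀ (F : Subset m) → (∀ (c : Cycle G) → Hits G F c) → m ∸ d ≤ ∣ F ∣)
      × ((d < m) ⇔ Cycle G)))
    × (∀ (v : Fin n) →
        (∃ λ d₁ → HasDim (S G) d₁) × (∃ λ d₂ → HasDim (Z₂E[_] G v ∩ˢ S G) d₂)
        × (∃ λ d₃ → HasDim (Z₂E[_] G v +ˢ S G) d₃)
        × (∀ d₁ d₂ d₃ → HasDim (S G) d₁ → HasDim (Z₂E[_] G v ∩ˢ S G) d₂
             → HasDim (Z₂E[_] G v +ˢ S G) d₃ →
             (∀ (cs : List (Cycle G)) → All (λ c → ContainsVertex G c v) cs
                → AllPairs (EdgeDisjoint G) cs → length cs ≤ ∣ E[_] G v ∣ ∸ d₂)
           × (∣ E[_] G v ∣ ∸ d₂ ≡ d₃ ∸ d₁)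
           × (∀ (F : Subset m) → F ⊆ E[_] G v
                → (∀ (c : Cycle G) → ContainsVertex G c v → Hits G F c)
                → d₃ ∸ d₁ ≤ ∣ F ∣)
           × ((d₂ < ∣ E[_] G v ∣) ⇔ (Σ (Cycle G) λ c → ContainsVertex G c v))))
    × (∀ (x : Fin m) → (Σ (Cycle G) λ c → ContainsEdge G c x) ⇔ (¬ S G ⁅ x ⁆))
corollary1p19 G =
  ( dim-exists (S? G)
  , λ _ dim → disjoint-cycles≤m∸dimS G dim , m∸dimS≤∣F∣ G dim , dimS<m⇔cycle G dim )
  , (λ v →
      dim-exists (S? G)
    , dim-exists (λ y → (y ⊆? E[_] G v) ×-dec S? G y)
    , dim-exists (+-dec (_⊆? E[_] G v) (S? G))
    , λ _ _ _ dim₁ dim₂ dim₃ →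
        disjoint-cycles≤∣E∣∸dim G v dim₂
      , ∣E∣∸dim∩≡dim+∸dimS G v dim₁ dim₂ dim₃
      , (λ F F⊆E hits → subst (_≤ ∣ F ∣) (∣E∣∸dim∩≡dim+∸dimS G v dim₁ dim₂ dim₃)
                                         (∣E∣∸dim≤∣F∣ G v dim₂ F F⊆E hits))
      , dim<∣E∣⇔cycle G v dim₂)
  , cycle-through⇔∉S G
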